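{- If $G$ and $H$ are connected graphs of order at least $2$, then $\mathrm{gp}_{\rm t}(G\circ H)=s(G)\,n(H)$ if $H$ is complete, and $\mathrm{gp}_{\rm t}(G\circ H)=0$ otherwise.
   Context: All graphs are finite and simple; $n(H)$ is the order of $H$. For $X\subseteq V(G)$, two vertices $u,v$ are $X$-positionable if no shortest $u,v$-path has an internal vertex in $X$. $X$ is a total general position set if every two vertices of $V(G)$ are $X$-positionable; $\mathrm{gp}_{\rm t}(G)$ is the maximum cardinality of such a set. $s(G)$ is the number of simplicial vertices (vertices whose neighbourhood induces a complete subgraph). The lexicographic product $G\circ H$ has vertex set $V(G)\times V(H)$, with $(g,h)$ and $(g',h')$ adjacent iff either $gg'\in E(G)$, or $g=g'$ and $hh'\in E(H)$. -}

module Defs where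

open import Data.Nat using (ℕ; zero; suc; _*_; _≤_; _<_)
open import Data.Fin using (Fin; zero; suc; remQuot; inject₁; toℕ)
import Data.Fin as Fin
open import Data.Fin.Subset using (Subset; ∣_∣; _∈_)
open import Data.Fin.Properties using (all?) renaming (_≟_ to _≟F_)
open import Data.Bool using (Bool; true; false; T; _∨_; _∧_)
open import Data.Vec using (Vec; lookup; head; last; tabulate)
open import Data.Product using (Σ; ∃; _×_; _,_; proj₁; proj₂)
open import Relation.Binary.PropositionalEquality using (_≡_; _≢_; refl)
import Relation.Binary.PropositionalEquality as ≡
open import Data.Empty using (⊥-elim)
open import Relation.Nullary using (¬_; Dec; does; yes; no)
open import Relation.Nullary.Decidable using (_→-dec_; ¬?)

record Graph (n : ℕ) : Set where
  field
    adj   : Fin n → Fin n → Bool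
    sym   : ∀ u v → adj u v ≡ adj v u
    irrfl : ∀ u → adj u u ≡ false
open Graph public

-- the order n(G) of G : Graph n is n.

Adj : ∀ {n} → Graph n → Fin n → Fin n → Set
Adj G u v = T (adj G u v)

record Walk {n} (G : Graph n) (u v : Fin n) (k : ℕ) : Set where
  field
    vs    : Vec (Fin n) (suc k)
    start : lookup vs zero ≡ u
    end   : lookup vs (Fin.fromℕ k) ≡ v
    steps : ∀ (i : Fin k) → Adj G (lookup vs (inject₁ i)) (lookup vs (suc i))
open Walk public

-- A shortest u,v-path: a u,v-walk of length k such that no u,v-walk is shorter.
-- (Such a walk is automatically a path, i.e. has no repeated vertices.)
IsShortest : ∀ {n} (G : Graph n) {u v : Fin n} {k : ℕ} → Walk G u v k → Set
IsShortest G {u} {v} {k} _ = ∀ j → j < k → ¬ Walk G u v j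

HasInternalIn : ∀ {n} {G : Graph n} {u v : Fin n} {k : ℕ} →
                Subset n → Walk G u v k → Set
HasInternalIn {k = k} X w =
  Σ (Fin (suc k)) λ i → (0 < toℕ i) × (toℕ i < k) × (lookup (vs w) i ∈ X)

Positionable : ∀ {n} (G : Graph n) → Subset n → Fin n → Fin n → Set
Positionable G X u v =
  ∀ (k : ℕ) (w : Walk G u v k) → IsShortest G w → ¬ HasInternalIn X w

IsTotalGPSet : ∀ {n} → Graph n → Subset n → Set
IsTotalGPSet G X = ∀ u v → Positionable G X u v

IsGpt : ∀ {n} → Graph n → ℕ → Set
IsGpt G m =
  (Σ (Subset _) λ X → IsTotalGPSet G X × ∣ X ∣ ≡ m) ×
  (∀ X → IsTotalGPSet G X → ∣ X ∣ ≤ m)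

Connected : ∀ {n} → Graph n → Set
Connected G = ∀ u v → ∃ λ k → Walk G u v k

Complete : ∀ {n} → Graph n → Set
Complete G = ∀ u v → u ≢ v → Adj G u v

Simplicial : ∀ {n} → Graph n → Fin n → Set
Simplicial G v = ∀ a b → Adj G v a → Adj G v b → a ≢ b → Adj G a b

Adj? : ∀ {n} (G : Graph n) u v → Dec (Adj G u v)
Adj? G u v with adj G u v
... | true  = yes _
... | false = no (λ ())

simplicial? : ∀ {n} (G : Graph n) v → Dec (Simplicial G v)
simplicial? G v =
  all? λ a → all? λ b →
    Adj? G v a →-dec (Adj? G v b →-dec (¬? (a ≟F b) →-dec Adj? G a b))

s : ∀ {n} → Graph n → ℕ
s {n} G = ∣ tabulate (λ v → does (simplicial? G v)) ∣

-- Lexicographic product G ∘ H on Fin (m * n); vertex i corresponds to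
-- (g , h) = remQuot n i (a bijection Fin (m * n) ≅ Fin m × Fin n).
-- (g,h) ~ (g',h')  iff  g g' ∈ E(G)  or  (g = g' and h h' ∈ E(H)).
lexAdj′ : ∀ {m n} → Graph m → Graph n → Fin m × Fin n → Fin m × Fin n → Bool
lexAdj′ G H (g , h) (g' , h') = adj G g g' ∨ (does (g ≟F g') ∧ adj H h h')

private
  does-sym : ∀ {m} (a b : Fin m) → does (a ≟F b) ≡ does (b ≟F a)
  does-sym a b with a ≟F b | b ≟F a
  ... | yes _ | yes _ = refl
  ... | no _  | no _  = refl
  ... | yes p | no q  = ⊥-elim (q (≡.sym p))
  ... | no p  | yes q = ⊥-elim (p (≡.sym q))

  does-refl : ∀ {m} (a : Fin m) → does (a ≟F a) ≡ true
  does-refl a with a ≟F a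
  ... | yes _ = refl
  ... | no p  = ⊥-elim (p refl)

_∘ₗ_ : ∀ {m n} → Graph m → Graph n → Graph (m * n)
_∘ₗ_ {m} {n} G H = record
  { adj   = λ i j → lexAdj′ G H (remQuot {m} n i) (remQuot {m} n j)
  ; sym   = λ i j → lemS (remQuot {m} n i) (remQuot {m} n j)
  ; irrfl = λ i → lemI (remQuot {m} n i)
  }
  where
  lemS : ∀ p q → lexAdj′ G H p q ≡ lexAdj′ G H q p
  lemS (g , h) (g' , h')
    rewrite Graph.sym G g g' | does-sym g g' | Graph.sym H h h' = refl
  lemI : ∀ p → lexAdj′ G H p p ≡ false
  lemI (g , h) rewrite irrfl G g | does-refl g | irrfl H h = refl

-- For every graph K, gpₜ(K) = s(K): if a shortest path passed through a
-- simplicial vertex x, its two path-neighbours would be equal or adjacent, so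
-- the path could be shortened; conversely, if x has two non-adjacent
-- neighbours a and b, then a x b is a shortest path with x inside, so x lies in
-- no total general position set.  It remains to count the simplicial vertices
-- of G ∘ H: when H is complete, (g , h) is simplicial exactly when g is; when
-- H has non-adjacent h₁ ≠ h₂, any vertex with a G-neighbour g′ sees the
-- non-adjacent pair (g′ , h₁), (g′ , h₂), so no vertex is simplicial.
module Submission where

open import Data.Bool using (Bool; true; false; T)
open import Data.Empty using (⊥-elim)
open import Data.Fin using (Fin; zero; suc; toℕ; inject₁; fromℕ; fromℕ<; combine; quotient; remainder; _↑ˡ_; _↑ʳ_)
open import Data.Fin.Properties using (toℕ-fromℕ; toℕ-inject₁; toℕ-fromℕ<; toℕ<n; remQuot-combine; combine-remQuot; combine-injectiveˡ; combine-injectiveʳ; splitAt-↑ʳ) renaming (_≟_ to _≟F_)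
open import Data.Fin.Subset using (Subset; _∈_; ∣_∣; inside; outside)
open import Data.Fin.Subset.Properties using (p⊆q⇒∣p∣≤∣q∣)
open import Data.Nat using (ℕ; zero; suc; _+_; _*_; _≤_; _<_; z≤n; s≤s; _≤?_)
open import Data.Nat.Properties using (≰⇒>; m<n⇒m<1+n; <-cmp; ≤-refl; ≤-antisym; ≤-reflexive; <⇒≤; <⇒≱; <-≤-trans; n≤1+n; m≤n⇒m≤1+n; m≤n+m; +-suc; +-monoʳ-<; *-suc; *-zeroʳ; *-distribʳ-+)
open import Data.Product using (∃; _×_; _,_; proj₁; proj₂)
open import Data.Sum using (_⊎_; inj₁; inj₂)
open import Data.Vec using (Vec; []; _∷_; lookup; tabulate; _++_)
open import Data.Vec.Properties using (lookup∘tabulate; tabulate-cong; []=⇒lookup; lookup⇒[]=)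
open import Function using (_∘_)
open import Function.Bundles using (mk⇔)
open import Relation.Binary.Definitions using (tri<; tri≈; tri>)
open import Relation.Binary.PropositionalEquality
open import Relation.Nullary using (¬_; Dec; yes; no; does)
open import Relation.Nullary.Decidable using (does-⇔; dec-true; dec-false; decidable-stable)

open import Defs hiding (sym)

∣p++q∣≡∣p∣+∣q∣ : ∀ {a b} (p : Subset a) (q : Subset b) → ∣ p ++ q ∣ ≡ ∣ p ∣ + ∣ q ∣
∣p++q∣≡∣p∣+∣q∣ []            q = refl
∣p++q∣≡∣p∣+∣q∣ (inside  ∷ p) q = cong suc (∣p++q∣≡∣p∣+∣q∣ p q)
∣p++q∣≡∣p∣+∣q∣ (outside ∷ p) q = ∣p++q∣≡∣p∣+∣q∣ p q

∣tabulate-const∣ : ∀ k (b : Bool) → ∣ tabulate {n = k} (λ _ → b) ∣ ≡ ∣ b ∷ [] ∣ * k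
∣tabulate-const∣ zero    b = sym (*-zeroʳ ∣ b ∷ [] ∣)
∣tabulate-const∣ (suc k) b = begin
  ∣ (b ∷ []) ++ bs ∣       ≡⟨ ∣p++q∣≡∣p∣+∣q∣ (b ∷ []) bs ⟩
  ∣ b ∷ [] ∣ + ∣ bs ∣      ≡⟨ cong (∣ b ∷ [] ∣ +_) (∣tabulate-const∣ k b) ⟩
  ∣ b ∷ [] ∣ + ∣ b ∷ [] ∣ * k  ≡⟨ sym (*-suc ∣ b ∷ [] ∣ k) ⟩
  ∣ b ∷ [] ∣ * suc k       ∎
  where
  open ≡-Reasoning
  bs = tabulate {n = k} (λ _ → b)

tabulate-++ : ∀ {A : Set} a b (f : Fin (a + b) → A) →
              tabulate f ≡ tabulate (f ∘ (_↑ˡ b)) ++ tabulate (f ∘ (a ↑ʳ_))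
tabulate-++ zero    b f = refl
tabulate-++ (suc a) b f = cong (f zero ∷_) (tabulate-++ a b (f ∘ suc))

∣tabulate∘quotient∣ : ∀ m n (f : Fin m → Bool) →
                      ∣ tabulate (f ∘ quotient {m} n) ∣ ≡ ∣ tabulate f ∣ * n
∣tabulate∘quotient∣ zero    n f = refl
∣tabulate∘quotient∣ (suc m) n f = begin
  ∣ tabulate (f ∘ quotient n) ∣            ≡⟨ cong ∣_∣ (tabulate-++ n (m * n) (f ∘ quotient n)) ⟩
  ∣ first-block ++ other-blocks ∣          ≡⟨ ∣p++q∣≡∣p∣+∣q∣ first-block other-blocks ⟩
  ∣ first-block ∣ + ∣ other-blocks ∣       ≡⟨ cong₂ _+_ ∣first-block∣ ∣other-blocks∣ ⟩
  ∣ f zero ∷ [] ∣ * n + ∣ fs ∣ * n         ≡⟨ sym (*-distribʳ-+ n ∣ f zero ∷ [] ∣ ∣ fs ∣) ⟩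
  (∣ f zero ∷ [] ∣ + ∣ fs ∣) * n           ≡⟨ cong (_* n) (sym (∣p++q∣≡∣p∣+∣q∣ (f zero ∷ []) fs)) ⟩
  ∣ tabulate f ∣ * n                       ∎
  where
  open ≡-Reasoning
  first-block = tabulate {n = n} (f ∘ quotient n ∘ (_↑ˡ m * n))
  other-blocks = tabulate {n = m * n} (f ∘ quotient n ∘ (n ↑ʳ_))
  fs = tabulate {n = m} (f ∘ suc)

  quotient-↑ʳ : ∀ j → quotient {suc m} n (n ↑ʳ j) ≡ suc (quotient {m} n j)
  quotient-↑ʳ j rewrite splitAt-↑ʳ n (m * n) j = refl

  ∣first-block∣ : ∣ first-block ∣ ≡ ∣ f zero ∷ [] ∣ * n
  ∣first-block∣ = trans (cong ∣_∣ (tabulate-cong λ j → cong (f ∘ proj₁) (remQuot-combine {k = n} zero j)))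
                        (∣tabulate-const∣ n (f zero))

  ∣other-blocks∣ : ∣ other-blocks ∣ ≡ ∣ fs ∣ * n
  ∣other-blocks∣ = trans (cong ∣_∣ (tabulate-cong (cong f ∘ quotient-↑ʳ)))
                         (∣tabulate∘quotient∣ m n (f ∘ suc))

another : ∀ {n} → 2 ≤ n → (u : Fin n) → ∃ (u ≢_)
another (s≤s (s≤s _)) zero    = suc zero , λ ()
another (s≤s (s≤s _)) (suc _) = zero , λ ()

module _ {n} (G : Graph n) where

  Adj-sym : ∀ {u v} → Adj G u v → Adj G v u
  Adj-sym {u} {v} = subst T (Graph.sym G u v)

  ¬Adj-refl : ∀ {u} → ¬ Adj G u u
  ¬Adj-refl {u} = subst T (irrfl G u)

  simplicial-closedNeighbours : ∀ {g a b} → Simplicial G g →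
    g ≡ a ⊎ Adj G g a → g ≡ b ⊎ Adj G g b → a ≡ b ⊎ Adj G a b
  simplicial-closedNeighbours S (inj₁ refl) (inj₁ refl) = inj₁ refl
  simplicial-closedNeighbours S (inj₁ refl) (inj₂ gb)   = inj₂ gb
  simplicial-closedNeighbours S (inj₂ ga)   (inj₁ refl) = inj₂ (Adj-sym ga)
  simplicial-closedNeighbours {a = a} {b} S (inj₂ ga) (inj₂ gb) with a ≟F b
  ... | yes a≡b = inj₁ a≡b
  ... | no  a≢b = inj₂ (S a b ga gb a≢b)

  simplicialSet : Subset n
  simplicialSet = tabulate (does ∘ simplicial? G)

  ∈-simplicialSet⁺ : ∀ {x} → Simplicial G x → x ∈ simplicialSet
  ∈-simplicialSet⁺ {x} Sx = lookup⇒[]= x simplicialSet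
    (trans (lookup∘tabulate (does ∘ simplicial? G) x) (dec-true (simplicial? G x) Sx))

  ∈-simplicialSet⁻ : ∀ {x} → x ∈ simplicialSet → Simplicial G x
  ∈-simplicialSet⁻ {x} x∈S = from-does (simplicial? G x)
    (trans (sym (lookup∘tabulate (does ∘ simplicial? G) x)) ([]=⇒lookup x∈S))
    where
    from-does : ∀ {A : Set} (a? : Dec A) → does a? ≡ true → A
    from-does (yes a) _ = a

  walk₀⇒≡ : ∀ {u v} → Walk G u v 0 → u ≡ v
  walk₀⇒≡ w = trans (sym (start w)) (end w)

  walk₁⇒Adj : ∀ {u v} → Walk G u v 1 → Adj G u v
  walk₁⇒Adj w = subst₂ (Adj G) (start w) (end w) (steps w zero)

  connected⇒neighbour : 2 ≤ n → Connected G → ∀ u → ∃ (Adj G u)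
  connected⇒neighbour 2≤n conn u with another 2≤n u
  ... | v , u≢v with conn u v
  ...   | zero  , w = ⊥-elim (u≢v (walk₀⇒≡ w))
  ...   | suc k , w = lookup (vs w) (suc zero) , subst (λ x → Adj G x _) (start w) (steps w zero)

  walk₂ : ∀ {a x b} → Adj G a x → Adj G x b → Walk G a b 2
  walk₂ {a} {x} {b} ax xb = record
    { vs    = a ∷ x ∷ b ∷ []
    ; start = refl
    ; end   = refl
    ; steps = λ { zero → ax ; (suc zero) → xb }
    }

  walk₂-shortest : ∀ {a x b} (ax : Adj G a x) (xb : Adj G x b) →
                   a ≢ b → ¬ Adj G a b → IsShortest G (walk₂ ax xb)
  walk₂-shortest ax xb a≢b ¬ab zero          _              w = a≢b (walk₀⇒≡ w)
  walk₂-shortest ax xb a≢b ¬ab (suc zero)    _              w = ¬ab (walk₁⇒Adj w)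
  walk₂-shortest ax xb a≢b ¬ab (suc (suc _)) (s≤s (s≤s ()))

  totalGP⇒simplicial : ∀ {X x} → IsTotalGPSet G X → x ∈ X → Simplicial G x
  totalGP⇒simplicial gp x∈X a b xa xb a≢b = decidable-stable (Adj? G a b) λ ¬ab →
    gp a b 2 (walk₂ (Adj-sym xa) xb) (walk₂-shortest (Adj-sym xa) xb a≢b ¬ab)
       (suc zero , s≤s z≤n , s≤s (s≤s z≤n) , x∈X)

  record FunWalk (u v : Fin n) (k : ℕ) : Set where
    field
      at     : ℕ → Fin n
      at-0   : at 0 ≡ u
      at-end : at k ≡ v
      step   : ∀ j → j < k → Adj G (at j) (at (suc j))
  open FunWalk

  -- Positions beyond the end of the vector read its last entry.
  vertexAt : ∀ {k} → Vec (Fin n) (suc k) → ℕ → Fin n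
  vertexAt             (x ∷ xs) zero    = x
  vertexAt {k = zero}  (x ∷ []) (suc j) = x
  vertexAt {k = suc k} (x ∷ xs) (suc j) = vertexAt xs j

  vertexAt-toℕ : ∀ {k} (xs : Vec (Fin n) (suc k)) i → vertexAt xs (toℕ i) ≡ lookup xs i
  vertexAt-toℕ             (x ∷ xs) zero    = refl
  vertexAt-toℕ {k = suc k} (x ∷ xs) (suc i) = vertexAt-toℕ xs i

  toFunWalk : ∀ {u v k} → Walk G u v k → FunWalk u v k
  toFunWalk {k = k} w = record
    { at     = vertexAt (vs w)
    ; at-0   = trans (vertexAt-toℕ (vs w) zero) (start w)
    ; at-end = trans (cong (vertexAt (vs w)) (sym (toℕ-fromℕ k)))
                     (trans (vertexAt-toℕ (vs w) (fromℕ k)) (end w))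
    ; step   = λ j j<k → let i = fromℕ< j<k in
        subst₂ (Adj G)
          (trans (sym (vertexAt-toℕ (vs w) (inject₁ i)))
                 (cong (vertexAt (vs w)) (trans (toℕ-inject₁ i) (toℕ-fromℕ< j<k))))
          (trans (sym (vertexAt-toℕ (vs w) (suc i)))
                 (cong (vertexAt (vs w) ∘ suc) (toℕ-fromℕ< j<k)))
          (steps w i)
    }

  fromFunWalk : ∀ {u v k} → FunWalk u v k → Walk G u v k
  fromFunWalk {k = k} w = record
    { vs    = tabulate (at w ∘ toℕ)
    ; start = trans (lookup∘tabulate (at w ∘ toℕ) (zero {k})) (at-0 w)
    ; end   = trans (lookup∘tabulate (at w ∘ toℕ) (fromℕ k))
                    (trans (cong (at w) (toℕ-fromℕ k)) (at-end w))
    ; steps = λ i → subst₂ (Adj G)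
        (sym (trans (lookup∘tabulate (at w ∘ toℕ) (inject₁ i)) (cong (at w) (toℕ-inject₁ i))))
        (sym (lookup∘tabulate (at w ∘ toℕ) (suc i)))
        (step w (toℕ i) (toℕ<n i))
    }

  splice : (ℕ → Fin n) → ℕ → ℕ → ℕ → Fin n
  splice f d p j with j ≤? p
  ... | yes _ = f j
  ... | no  _ = f (d + j)

  splice-≤ : ∀ f d p {j} → j ≤ p → splice f d p j ≡ f j
  splice-≤ f d p {j} j≤p with j ≤? p
  ... | yes _   = refl
  ... | no  j≰p = ⊥-elim (j≰p j≤p)

  splice-> : ∀ f d p {j} → p < j → splice f d p j ≡ f (d + j)
  splice-> f d p {j} p<j with j ≤? p
  ... | yes j≤p = ⊥-elim (<⇒≱ p<j j≤p)
  ... | no  _   = refl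

  -- The walk at w 0, …, at w p, at w (d + suc p), …, at w (d + k).
  cutAfter : ∀ {u v} d {k} (w : FunWalk u v (d + k)) p → p ≤ k →
             (p < k → Adj G (at w p) (at w (d + suc p))) → (p ≡ k → at w p ≡ v) →
             FunWalk u v k
  cutAfter {v = v} d {k} w p p≤k join p-last = record
    { at     = splice (at w) d p
    ; at-0   = trans (splice-≤ (at w) d p z≤n) (at-0 w)
    ; at-end = at-end′ (k ≤? p)
    ; step   = step′
    }
    where
    at-end′ : Dec (k ≤ p) → splice (at w) d p k ≡ v
    at-end′ (yes k≤p) = let p≡k = ≤-antisym p≤k k≤p in
      trans (splice-≤ (at w) d p k≤p) (trans (cong (at w) (sym p≡k)) (p-last p≡k))
    at-end′ (no k≰p) = trans (splice-> (at w) d p (≰⇒> k≰p)) (at-end w)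

    step′ : ∀ j → j < k → Adj G (splice (at w) d p j) (splice (at w) d p (suc j))
    step′ j j<k with <-cmp j p
    ... | tri< j<p _ _ = subst₂ (Adj G)
      (sym (splice-≤ (at w) d p (<⇒≤ j<p))) (sym (splice-≤ (at w) d p j<p))
      (step w j (<-≤-trans j<k (m≤n+m k d)))
    ... | tri≈ _ refl _ = subst₂ (Adj G)
      (sym (splice-≤ (at w) d p ≤-refl)) (sym (splice-> (at w) d p ≤-refl))
      (join j<k)
    ... | tri> _ _ p<j = subst₂ (Adj G)
      (sym (splice-> (at w) d p p<j))
      (sym (trans (splice-> (at w) d p (m<n⇒m<1+n p<j)) (cong (at w) (+-suc d j))))
      (step w (d + j) (+-monoʳ-< d j<k))

  shortcut : ∀ {u v k} (w : FunWalk u v k) p → suc p < k → Simplicial G (at w (suc p)) →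
             ∃ λ j → j < k × FunWalk u v j
  shortcut {k = suc (suc k)} w p (s≤s (s≤s p≤k)) S with at w p ≟F at w (2 + p)
  ... | no a≢b = suc k , ≤-refl ,
    cutAfter 1 w p (m≤n⇒m≤1+n p≤k) (λ _ → S _ _ before after a≢b)
      (λ p≡1+k → ⊥-elim (<⇒≱ (s≤s p≤k) (≤-reflexive (sym p≡1+k))))
    where
    before = Adj-sym (step w p (m≤n⇒m≤1+n (s≤s p≤k)))
    after  = step w (suc p) (s≤s (s≤s p≤k))
  ... | yes a≡b = k , n≤1+n (suc k) ,
    cutAfter 2 w p p≤k
      (λ p<k → subst (λ x → Adj G x (at w (3 + p))) (sym a≡b) (step w (2 + p) (s≤s (s≤s p<k))))
      (λ p≡k → trans a≡b (trans (cong (at w ∘ (2 +_)) p≡k) (at-end w)))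

  simplicialSet-totalGP : IsTotalGPSet G simplicialSet
  simplicialSet-totalGP u v k w shortest (i , 0<i , i<k , i∈S) with toℕ i in eq
  ... | suc p with shortcut (toFunWalk w) p i<k
                     (subst (Simplicial G) (sym (trans (cong (vertexAt (vs w)) (sym eq)) (vertexAt-toℕ (vs w) i)))
                        (∈-simplicialSet⁻ i∈S))
  ...   | j , j<k , w′ = shortest j j<k (fromFunWalk w′)

IsGpt-s : ∀ {n} (G : Graph n) → IsGpt G (s G)
IsGpt-s G = (simplicialSet G , simplicialSet-totalGP G , refl) ,
            λ X gp → p⊆q⇒∣p∣≤∣q∣ (∈-simplicialSet⁺ G ∘ totalGP⇒simplicial G gp)

module Lexicographic {m n} (G : Graph m) (H : Graph n) where

  π₁ : Fin (m * n) → Fin m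
  π₁ = quotient n

  π₂ : Fin (m * n) → Fin n
  π₂ = remainder {m} n

  coordinates-injective : ∀ {i j} → π₁ i ≡ π₁ j → π₂ i ≡ π₂ j → i ≡ j
  coordinates-injective {i} {j} e₁ e₂ =
    trans (sym (combine-remQuot {m} n i)) (trans (cong₂ combine e₁ e₂) (combine-remQuot {m} n j))

  π₁-combine : ∀ g h → π₁ (combine g h) ≡ g
  π₁-combine g h = cong proj₁ (remQuot-combine {k = n} g h)

  π₂-combine : ∀ (g : Fin m) h → π₂ (combine g h) ≡ h
  π₂-combine g h = cong proj₂ (remQuot-combine {k = n} g h)

  adjᴳ : ∀ {i j} → Adj G (π₁ i) (π₁ j) → Adj (G ∘ₗ H) i j
  adjᴳ {i} {j} a with adj G (π₁ i) (π₁ j)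
  ... | true = _

  adjᴴ : ∀ {i j} → π₁ i ≡ π₁ j → Adj H (π₂ i) (π₂ j) → Adj (G ∘ₗ H) i j
  adjᴴ {i} {j} e a with adj G (π₁ i) (π₁ j) | π₁ i ≟F π₁ j
  ... | true  | _      = _
  ... | false | yes _  = a
  ... | false | no  ne = ⊥-elim (ne e)

  adj-cases : ∀ {i j} → Adj (G ∘ₗ H) i j →
              Adj G (π₁ i) (π₁ j) ⊎ (π₁ i ≡ π₁ j × Adj H (π₂ i) (π₂ j))
  adj-cases {i} {j} a with adj G (π₁ i) (π₁ j) | π₁ i ≟F π₁ j
  ... | true  | _     = inj₁ _
  ... | false | yes e = inj₂ (e , a)

  adj-combine : ∀ {i g} h → Adj G (π₁ i) g → Adj (G ∘ₗ H) i (combine g h)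
  adj-combine {i} {g} h a = adjᴳ (subst (Adj G (π₁ i)) (sym (π₁-combine g h)) a)

  closedAdjᴳ⇒adj : Complete H → ∀ {i j} → i ≢ j →
                   π₁ i ≡ π₁ j ⊎ Adj G (π₁ i) (π₁ j) → Adj (G ∘ₗ H) i j
  closedAdjᴳ⇒adj H-complete i≢j (inj₁ e) =
    adjᴴ e (H-complete _ _ (λ e₂ → i≢j (coordinates-injective e e₂)))
  closedAdjᴳ⇒adj H-complete i≢j (inj₂ a) = adjᴳ a

  combine-adj-cases : ∀ {a b h h′} → Adj (G ∘ₗ H) (combine a h) (combine b h′) →
                      Adj G a b ⊎ (a ≡ b × Adj H h h′)
  combine-adj-cases {a} {b} {h} {h′} t with adj-cases t
  ... | inj₁ ab       = inj₁ (subst₂ (Adj G) (π₁-combine a h) (π₁-combine b h′) ab)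
  ... | inj₂ (e , hh) = inj₂ (subst₂ _≡_ (π₁-combine a h) (π₁-combine b h′) e ,
                              subst₂ (Adj H) (π₂-combine a h) (π₂-combine b h′) hh)

  simplicial⇒simplicialᴳ : ∀ {i} → Simplicial (G ∘ₗ H) i → Simplicial G (π₁ i)
  simplicial⇒simplicialᴳ {i} S a b ia ib a≢b
    with combine-adj-cases (S (combine a (π₂ i)) (combine b (π₂ i)) (adj-combine _ ia) (adj-combine _ ib)
                              (a≢b ∘ combine-injectiveˡ a _ b _))
  ... | inj₁ ab       = ab
  ... | inj₂ (a≡b , _) = ⊥-elim (a≢b a≡b)

  simplicial⇒complete : ∀ {i g} → Simplicial (G ∘ₗ H) i → Adj G (π₁ i) g → Complete H
  simplicial⇒complete {i} {g} S ig h₁ h₂ h₁≢h₂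
    with combine-adj-cases (S (combine g h₁) (combine g h₂) (adj-combine h₁ ig) (adj-combine h₂ ig)
                              (h₁≢h₂ ∘ combine-injectiveʳ g h₁ g h₂))
  ... | inj₁ gg       = ⊥-elim (¬Adj-refl G gg)
  ... | inj₂ (_ , hh) = hh

  simplicialᴳ⇒simplicial : Complete H → ∀ {i} → Simplicial G (π₁ i) → Simplicial (G ∘ₗ H) i
  simplicialᴳ⇒simplicial H-complete {i} S j k ij ik j≢k =
    closedAdjᴳ⇒adj H-complete j≢k
      (simplicial-closedNeighbours G S (closedAdjᴳ ij) (closedAdjᴳ ik))
    where
    closedAdjᴳ : ∀ {j} → Adj (G ∘ₗ H) i j → π₁ i ≡ π₁ j ⊎ Adj G (π₁ i) (π₁ j)
    closedAdjᴳ a with adj-cases a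
    ... | inj₁ a′      = inj₂ a′
    ... | inj₂ (e , _) = inj₁ e

  s-∘ₗ-complete : Complete H → s (G ∘ₗ H) ≡ s G * n
  s-∘ₗ-complete H-complete = begin
    ∣ tabulate (does ∘ simplicial? (G ∘ₗ H)) ∣  ≡⟨ cong ∣_∣ (tabulate-cong same-decision) ⟩
    ∣ tabulate (does ∘ simplicial? G ∘ π₁) ∣    ≡⟨ ∣tabulate∘quotient∣ m n (does ∘ simplicial? G) ⟩
    s G * n                                     ∎
    where
    open ≡-Reasoning
    same-decision : ∀ i → does (simplicial? (G ∘ₗ H) i) ≡ does (simplicial? G (π₁ i))
    same-decision i = does-⇔ (mk⇔ simplicial⇒simplicialᴳ (simplicialᴳ⇒simplicial H-complete))
                             (simplicial? (G ∘ₗ H) i) (simplicial? G (π₁ i))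

  s-∘ₗ-incomplete : (∀ g → ∃ (Adj G g)) → ¬ Complete H → s (G ∘ₗ H) ≡ 0
  s-∘ₗ-incomplete neighbour ¬complete =
    trans (cong ∣_∣ (tabulate-cong none-simplicial)) (∣tabulate-const∣ (m * n) false)
    where
    none-simplicial : ∀ i → does (simplicial? (G ∘ₗ H) i) ≡ false
    none-simplicial i = dec-false (simplicial? (G ∘ₗ H) i)
      (λ S → ¬complete (simplicial⇒complete S (proj₂ (neighbour (π₁ i)))))

open Lexicographic using (s-∘ₗ-complete; s-∘ₗ-incomplete)

corollary5p2 : ∀ {m n} (G : Graph m) (H : Graph n) →
    2 ≤ m → 2 ≤ n → Connected G → Connected H →
    (Complete H → IsGpt (G ∘ₗ H) (s G * n)) ×
    (¬ Complete H → IsGpt (G ∘ₗ H) 0)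
corollary5p2 G H 2≤m _ G-connected _ =
  (λ H-complete → subst (IsGpt (G ∘ₗ H)) (s-∘ₗ-complete G H H-complete) (IsGpt-s (G ∘ₗ H))) ,
  (λ ¬complete → subst (IsGpt (G ∘ₗ H))
     (s-∘ₗ-incomplete G H (connected⇒neighbour G 2≤m G-connected) ¬complete) (IsGpt-s (G ∘ₗ H)))
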